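{- Let $\mathcal{A}=\{A_0,A_1,A_2\}$ be the standard basis of a symmetric rank $3$ standard integral table algebra with character table $$\begin{bmatrix}1&r&m(1+r)\\ 1&r&-1-r\\ 1&-1&0\end{bmatrix},$$ i.e. $k=r$, $s=-1$ and $\ell=m(1+r)$ (as when $A_1$ is the adjacency matrix of a disjoint union of $m+1$ copies of the complete graph $K_{r+1}$). Then each of the following partitions of $\{2,\dots,9\}$ gives a fusion of $\mathcal{A}\otimes\mathcal{A}$: $2|3|4|5|6|78|9$, $2|36|4|5|7|8|9$; $2|3|4|5|6|789$, $2|3|45|6|78|9$, $2|36|4|5|78|9$, $2|369|4|5|7|8$, $25|36|4|7|8|9$; $2|3|45|6|789$, $2|36|45|78|9$, $2|3678|4|5|9$, $2|369|4|5|78$, $24|36|5|78|9$, $2|36|4|5|789$, $25|36|4|78|9$, $25|369|4|7|8$; $2|36|45|789$, $25|369|4|78$, $2|3|456|789$, $2|36789|4|5$, $258|369|4|7$, $2|3|4578|69$, $23|4|56|789$, $245|36|78|9$, $2356|4|7|89$, $2|369|47|58$, $2|3678|45|9$, $2|369|45|78$, $24|3678|5|9$, $25|36|4|789$, $25|3678|4|9$, $24|36|5|789$, $24|369|5|78$; $2|3456|789$, $2|36789|45$, $24|36789|5$, $2578|4|369$, $2356|4|789$, $245|36|789$, $245|369|78$, $25|36789|4$, $245|3678|9$, $2|369|4578$; $2|3456789$, $23456|789$, $2356789|4$, $24578|369$, $245|36789$.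
   Context: A symmetric rank $3$ standard integral table algebra is a commutative associative complex algebra with basis $A_0=1,A_1,A_2$ such that the structure constants $\lambda_{ijh}$ ($A_iA_j=\sum_h\lambda_{ijh}A_h$) are nonnegative reals, $\lambda_{ij0}=0$ for $i\neq j$, and $\lambda_{ii0}=\delta(A_i)$ is a positive integer, where $\delta$ is the valency homomorphism. Main example: $A_0=I_n$, $A_1$ the adjacency matrix of a strongly regular graph, $A_2=J-I-A_1$. With $k=\delta(A_1)$, $\ell=\delta(A_2)$, the character table (rows: characters $\chi_0=\delta,\chi_1,\chi_2$; columns: $A_0,A_1,A_2$) has the form $[1,k,\ell;\,1,r,-1-r;\,1,s,-1-s]$. The tensor square $\mathcal{A}\otimes\mathcal{A}$ has basis $A_{ij}=A_i\otimes A_j$, relabelled $C_{3j+i+1}=A_{ij}$: $C_1=A_{00},C_2=A_{10},C_3=A_{20},C_4=A_{01},C_5=A_{11},C_6=A_{21},C_7=A_{02},C_8=A_{12},C_9=A_{22}$. Partitions of $\{2,\dots,9\}$ are written with blocks separated by bars. A partition $\tau$ gives a fusion of $\mathcal{A}\otimes\mathcal{A}$ if the span of $C_1$ and the block sums $\sum_{t\in T}C_t$ ($T$ a block of $\tau$) is closed under multiplication.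
   Formalization: The structure constants $\lambda_{ijh}$ of the table algebra and the parameters $r$ and $m$ of its character table are taken in ℚ rather than in the nonnegative reals and real numbers. -}

module Defs where

open import Data.Nat using (ℕ; zero; suc; _≡ᵇ_)
open import Data.Bool using (if_then_else_)
open import Data.Integer using (+_)
open import Data.Rational using (ℚ; 0ℚ; 1ℚ; _+_; _*_; _≤_; -_; _/_)
open import Data.Fin using (Fin; zero; suc)
open import Data.List using (List; []; _∷_; map; foldr; length; lookup; allFin)
open import Data.Product using (_×_; _,_; proj₁; proj₂; Σ; ∃)
open import Data.List.Membership.Propositional using (_∈_)
open import Relation.Nullary.Decidable using (isYes)
import Data.Fin
open import Relation.Binary.PropositionalEquality using (_≡_; _≢_)

ℕ→ℚ : ℕ → ℚ
ℕ→ℚ n = (+ n) / 1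

Σ₃ : (Fin 3 → ℚ) → ℚ
Σ₃ f = f zero + f (suc zero) + f (suc (suc zero))

sumℚ : List ℚ → ℚ
sumℚ = foldr _+_ 0ℚ

δ₃ : Fin 3 → Fin 3 → ℚ
δ₃ i j = if isYes (i Data.Fin.≟ j) then 1ℚ else 0ℚ

𝟘 𝟙 𝟚 : Fin 3
𝟘 = zero
𝟙 = suc zero
𝟚 = suc (suc zero)

-- A symmetric rank 3 standard integral table algebra, given by its structure
-- constants lam i j h  (A_i A_j = Σ_h lam i j h A_h) w.r.t. the standard basis
-- A_0 = 1, A_1, A_2, together with its valency homomorphism δ.
record TableAlgebra3 : Set where
  field
    lam    : Fin 3 → Fin 3 → Fin 3 → ℚ
    δ      : Fin 3 → ℕ
    unitˡ  : ∀ j h → lam 𝟘 j h ≡ δ₃ j h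
    comm   : ∀ i j h → lam i j h ≡ lam j i h
    assoc  : ∀ i j k t →
             Σ₃ (λ h → lam i j h * lam h k t) ≡ Σ₃ (λ h → lam j k h * lam i h t)
    nonneg : ∀ i j h → 0ℚ ≤ lam i j h
    -- symmetric table algebra: λ_{ij0} = 0 for i ≠ j, λ_{ii0} = δ(A_i)
    off0   : ∀ i j → i ≢ j → lam i j 𝟘 ≡ 0ℚ
    diag0  : ∀ i → lam i i 𝟘 ≡ ℕ→ℚ (δ i)
    δpos   : ∀ i → δ i ≢ 0
    δhom   : ∀ i j → ℕ→ℚ (δ i) * ℕ→ℚ (δ j) ≡ Σ₃ (λ h → lam i j h * ℕ→ℚ (δ h))

open TableAlgebra3 public

IsCharacter : TableAlgebra3 → (Fin 3 → ℚ) → Set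
IsCharacter A χ = ∀ i j → χ i * χ j ≡ Σ₃ (λ h → lam A i j h * χ h)

row : ℚ → ℚ → ℚ → Fin 3 → ℚ
row a b c zero = a
row a b c (suc zero) = b
row a b c (suc (suc zero)) = c

HasCharTable : TableAlgebra3 → ℚ → ℚ → Set
HasCharTable A r m =
  (∀ i → ℕ→ℚ (δ A i) ≡ row 1ℚ r (m * (1ℚ + r)) i)
  × IsCharacter A (row 1ℚ r (m * (1ℚ + r)))
  × IsCharacter A (row 1ℚ r (- 1ℚ + - r))
  × IsCharacter A (row 1ℚ (- 1ℚ) 0ℚ)

-- Labels of the basis of A ⊗ A: C_{3j+i+1} = A_i ⊗ A_j, i.e. label ↦ (i , j).
-- (Only labels 1..9 are meaningful; other labels are never used.)
label : ℕ → Fin 3 × Fin 3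
label 1 = 𝟘 , 𝟘
label 2 = 𝟙 , 𝟘
label 3 = 𝟚 , 𝟘
label 4 = 𝟘 , 𝟙
label 5 = 𝟙 , 𝟙
label 6 = 𝟚 , 𝟙
label 7 = 𝟘 , 𝟚
label 8 = 𝟙 , 𝟚
label 9 = 𝟚 , 𝟚
label _ = 𝟘 , 𝟘

labels : List ℕ
labels = 1 ∷ 2 ∷ 3 ∷ 4 ∷ 5 ∷ 6 ∷ 7 ∷ 8 ∷ 9 ∷ []

lam⊗ : TableAlgebra3 → ℕ → ℕ → ℕ → ℚ
lam⊗ A t u v =
  lam A (proj₁ (label t)) (proj₁ (label u)) (proj₁ (label v)) *
  lam A (proj₂ (label t)) (proj₂ (label u)) (proj₂ (label v))

prodCoeff : TableAlgebra3 → List ℕ → List ℕ → ℕ → ℚ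
prodCoeff A T U v = sumℚ (map (λ t → sumℚ (map (λ u → lam⊗ A t u v) U)) T)

memℚ : ℕ → List ℕ → ℚ
memℚ v [] = 0ℚ
memℚ v (w ∷ W) = if v ≡ᵇ w then 1ℚ else memℚ v W

Partition : Set
Partition = List (List ℕ)

generators : Partition → List (List ℕ)
generators τ = (1 ∷ []) ∷ τ

-- τ gives a fusion of A ⊗ A: the span of C_1 and the block sums is closed
-- under multiplication, i.e. the product of any two spanning elements is a
-- linear combination of the spanning elements.
IsFusion : TableAlgebra3 → Partition → Set
IsFusion A τ =
  ∀ {T U} → T ∈ generators τ → U ∈ generators τ →
  ∃ λ (c : Fin (length (generators τ)) → ℚ) →
    ∀ {v} → v ∈ labels →
      prodCoeff A T U v ≡
      sumℚ (map (λ k → c k * memℚ v (lookup (generators τ) k))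
                (allFin (length (generators τ))))

theorem4p2Partitions : List Partition
theorem4p2Partitions =
  (
    ((2 ∷ []) ∷ (3 ∷ []) ∷ (4 ∷ []) ∷ (5 ∷ []) ∷ (6 ∷ []) ∷ (7 ∷ 8 ∷ []) ∷ (9 ∷ []) ∷ [])
  ∷
    ((2 ∷ []) ∷ (3 ∷ 6 ∷ []) ∷ (4 ∷ []) ∷ (5 ∷ []) ∷ (7 ∷ []) ∷ (8 ∷ []) ∷ (9 ∷ []) ∷ [])
  ∷
    ((2 ∷ []) ∷ (3 ∷ []) ∷ (4 ∷ []) ∷ (5 ∷ []) ∷ (6 ∷ []) ∷ (7 ∷ 8 ∷ 9 ∷ []) ∷ [])
  ∷
    ((2 ∷ []) ∷ (3 ∷ []) ∷ (4 ∷ 5 ∷ []) ∷ (6 ∷ []) ∷ (7 ∷ 8 ∷ []) ∷ (9 ∷ []) ∷ [])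
  ∷
    ((2 ∷ []) ∷ (3 ∷ 6 ∷ []) ∷ (4 ∷ []) ∷ (5 ∷ []) ∷ (7 ∷ 8 ∷ []) ∷ (9 ∷ []) ∷ [])
  ∷
    ((2 ∷ []) ∷ (3 ∷ 6 ∷ 9 ∷ []) ∷ (4 ∷ []) ∷ (5 ∷ []) ∷ (7 ∷ []) ∷ (8 ∷ []) ∷ [])
  ∷
    ((2 ∷ 5 ∷ []) ∷ (3 ∷ 6 ∷ []) ∷ (4 ∷ []) ∷ (7 ∷ []) ∷ (8 ∷ []) ∷ (9 ∷ []) ∷ [])
  ∷
    ((2 ∷ []) ∷ (3 ∷ []) ∷ (4 ∷ 5 ∷ []) ∷ (6 ∷ []) ∷ (7 ∷ 8 ∷ 9 ∷ []) ∷ [])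
  ∷
    ((2 ∷ []) ∷ (3 ∷ 6 ∷ []) ∷ (4 ∷ 5 ∷ []) ∷ (7 ∷ 8 ∷ []) ∷ (9 ∷ []) ∷ [])
  ∷
    ((2 ∷ []) ∷ (3 ∷ 6 ∷ 7 ∷ 8 ∷ []) ∷ (4 ∷ []) ∷ (5 ∷ []) ∷ (9 ∷ []) ∷ [])
  ∷
    ((2 ∷ []) ∷ (3 ∷ 6 ∷ 9 ∷ []) ∷ (4 ∷ []) ∷ (5 ∷ []) ∷ (7 ∷ 8 ∷ []) ∷ [])
  ∷
    ((2 ∷ 4 ∷ []) ∷ (3 ∷ 6 ∷ []) ∷ (5 ∷ []) ∷ (7 ∷ 8 ∷ []) ∷ (9 ∷ []) ∷ [])
  ∷
    ((2 ∷ []) ∷ (3 ∷ 6 ∷ []) ∷ (4 ∷ []) ∷ (5 ∷ []) ∷ (7 ∷ 8 ∷ 9 ∷ []) ∷ [])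
  ∷
    ((2 ∷ 5 ∷ []) ∷ (3 ∷ 6 ∷ []) ∷ (4 ∷ []) ∷ (7 ∷ 8 ∷ []) ∷ (9 ∷ []) ∷ [])
  ∷
    ((2 ∷ 5 ∷ []) ∷ (3 ∷ 6 ∷ 9 ∷ []) ∷ (4 ∷ []) ∷ (7 ∷ []) ∷ (8 ∷ []) ∷ [])
  ∷
    ((2 ∷ []) ∷ (3 ∷ 6 ∷ []) ∷ (4 ∷ 5 ∷ []) ∷ (7 ∷ 8 ∷ 9 ∷ []) ∷ [])
  ∷
    ((2 ∷ 5 ∷ []) ∷ (3 ∷ 6 ∷ 9 ∷ []) ∷ (4 ∷ []) ∷ (7 ∷ 8 ∷ []) ∷ [])
  ∷
    ((2 ∷ []) ∷ (3 ∷ []) ∷ (4 ∷ 5 ∷ 6 ∷ []) ∷ (7 ∷ 8 ∷ 9 ∷ []) ∷ [])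
  ∷
    ((2 ∷ []) ∷ (3 ∷ 6 ∷ 7 ∷ 8 ∷ 9 ∷ []) ∷ (4 ∷ []) ∷ (5 ∷ []) ∷ [])
  ∷
    ((2 ∷ 5 ∷ 8 ∷ []) ∷ (3 ∷ 6 ∷ 9 ∷ []) ∷ (4 ∷ []) ∷ (7 ∷ []) ∷ [])
  ∷
    ((2 ∷ []) ∷ (3 ∷ []) ∷ (4 ∷ 5 ∷ 7 ∷ 8 ∷ []) ∷ (6 ∷ 9 ∷ []) ∷ [])
  ∷
    ((2 ∷ 3 ∷ []) ∷ (4 ∷ []) ∷ (5 ∷ 6 ∷ []) ∷ (7 ∷ 8 ∷ 9 ∷ []) ∷ [])
  ∷
    ((2 ∷ 4 ∷ 5 ∷ []) ∷ (3 ∷ 6 ∷ []) ∷ (7 ∷ 8 ∷ []) ∷ (9 ∷ []) ∷ [])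
  ∷
    ((2 ∷ 3 ∷ 5 ∷ 6 ∷ []) ∷ (4 ∷ []) ∷ (7 ∷ []) ∷ (8 ∷ 9 ∷ []) ∷ [])
  ∷
    ((2 ∷ []) ∷ (3 ∷ 6 ∷ 9 ∷ []) ∷ (4 ∷ 7 ∷ []) ∷ (5 ∷ 8 ∷ []) ∷ [])
  ∷
    ((2 ∷ []) ∷ (3 ∷ 6 ∷ 7 ∷ 8 ∷ []) ∷ (4 ∷ 5 ∷ []) ∷ (9 ∷ []) ∷ [])
  ∷
    ((2 ∷ []) ∷ (3 ∷ 6 ∷ 9 ∷ []) ∷ (4 ∷ 5 ∷ []) ∷ (7 ∷ 8 ∷ []) ∷ [])
  ∷
    ((2 ∷ 4 ∷ []) ∷ (3 ∷ 6 ∷ 7 ∷ 8 ∷ []) ∷ (5 ∷ []) ∷ (9 ∷ []) ∷ [])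
  ∷
    ((2 ∷ 5 ∷ []) ∷ (3 ∷ 6 ∷ []) ∷ (4 ∷ []) ∷ (7 ∷ 8 ∷ 9 ∷ []) ∷ [])
  ∷
    ((2 ∷ 5 ∷ []) ∷ (3 ∷ 6 ∷ 7 ∷ 8 ∷ []) ∷ (4 ∷ []) ∷ (9 ∷ []) ∷ [])
  ∷
    ((2 ∷ 4 ∷ []) ∷ (3 ∷ 6 ∷ []) ∷ (5 ∷ []) ∷ (7 ∷ 8 ∷ 9 ∷ []) ∷ [])
  ∷
    ((2 ∷ 4 ∷ []) ∷ (3 ∷ 6 ∷ 9 ∷ []) ∷ (5 ∷ []) ∷ (7 ∷ 8 ∷ []) ∷ [])
  ∷
    ((2 ∷ []) ∷ (3 ∷ 4 ∷ 5 ∷ 6 ∷ []) ∷ (7 ∷ 8 ∷ 9 ∷ []) ∷ [])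
  ∷
    ((2 ∷ []) ∷ (3 ∷ 6 ∷ 7 ∷ 8 ∷ 9 ∷ []) ∷ (4 ∷ 5 ∷ []) ∷ [])
  ∷
    ((2 ∷ 4 ∷ []) ∷ (3 ∷ 6 ∷ 7 ∷ 8 ∷ 9 ∷ []) ∷ (5 ∷ []) ∷ [])
  ∷
    ((2 ∷ 5 ∷ 7 ∷ 8 ∷ []) ∷ (4 ∷ []) ∷ (3 ∷ 6 ∷ 9 ∷ []) ∷ [])
  ∷
    ((2 ∷ 3 ∷ 5 ∷ 6 ∷ []) ∷ (4 ∷ []) ∷ (7 ∷ 8 ∷ 9 ∷ []) ∷ [])
  ∷
    ((2 ∷ 4 ∷ 5 ∷ []) ∷ (3 ∷ 6 ∷ []) ∷ (7 ∷ 8 ∷ 9 ∷ []) ∷ [])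
  ∷
    ((2 ∷ 4 ∷ 5 ∷ []) ∷ (3 ∷ 6 ∷ 9 ∷ []) ∷ (7 ∷ 8 ∷ []) ∷ [])
  ∷
    ((2 ∷ 5 ∷ []) ∷ (3 ∷ 6 ∷ 7 ∷ 8 ∷ 9 ∷ []) ∷ (4 ∷ []) ∷ [])
  ∷
    ((2 ∷ 4 ∷ 5 ∷ []) ∷ (3 ∷ 6 ∷ 7 ∷ 8 ∷ []) ∷ (9 ∷ []) ∷ [])
  ∷
    ((2 ∷ []) ∷ (3 ∷ 6 ∷ 9 ∷ []) ∷ (4 ∷ 5 ∷ 7 ∷ 8 ∷ []) ∷ [])
  ∷
    ((2 ∷ []) ∷ (3 ∷ 4 ∷ 5 ∷ 6 ∷ 7 ∷ 8 ∷ 9 ∷ []) ∷ [])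
  ∷
    ((2 ∷ 3 ∷ 4 ∷ 5 ∷ 6 ∷ []) ∷ (7 ∷ 8 ∷ 9 ∷ []) ∷ [])
  ∷
    ((2 ∷ 3 ∷ 5 ∷ 6 ∷ 7 ∷ 8 ∷ 9 ∷ []) ∷ (4 ∷ []) ∷ [])
  ∷
    ((2 ∷ 4 ∷ 5 ∷ 7 ∷ 8 ∷ []) ∷ (3 ∷ 6 ∷ 9 ∷ []) ∷ [])
  ∷
    ((2 ∷ 4 ∷ 5 ∷ []) ∷ (3 ∷ 6 ∷ 7 ∷ 8 ∷ 9 ∷ []) ∷ [])
  ∷ [])

-- Write ℓ = m (1 + r).  The valencies make 1 + r and 1 + r + ℓ positive, so the character table
-- is invertible and the characters determine the structure constants:
--   A₁² = r A₀ + (r − 1) A₁,   A₁ A₂ = r A₂,   A₂² = ℓ A₀ + ℓ A₁ + (ℓ − r − 1) A₂.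
-- Hence every structure constant of A ⊗ A is an integer polynomial of degree at most 2 in r and ℓ,
-- and closure under multiplication of the span attached to a partition becomes a finite family of
-- polynomial identities, which is decided by computing with coefficient vectors.

module Submission where

open import Defs
open import Data.Bool.Base using (true; false; if_then_else_)
open import Data.Nat.Base using (ℕ; _≡ᵇ_)
open import Data.Integer.Base as ℤ using (ℤ; 0ℤ; 1ℤ; -1ℤ)
open import Data.Integer.Properties using () renaming (_≟_ to _≟ℤ_)
import Data.Integer.Tactic.RingSolver as ℤ-Solver
open import Data.Rational.Base
  using (ℚ; 0ℚ; 1ℚ; _+_; _*_; -_; _-_; _/_; 1/_; NonZero; Positive; NonNegative; fromℚᵘ; toℚᵘ)
open import Data.Rational.Properties
  using ( toℚᵘ-injective; toℚᵘ-fromℚᵘ; toℚᵘ-homo-+; toℚᵘ-homo-*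
        ; fromℚᵘ-cong; *-inverseˡ; *-identityˡ; *-identityʳ; *-zeroʳ; *-assoc
        ; normalize-nonNeg; pos+nonNeg⇒pos; pos⇒nonZero)
open import Data.Rational.Unnormalised.Base as ℚᵘ using (mkℚᵘ; *≡*)
import Data.Rational.Unnormalised.Properties as ℚᵘ
open import Data.Fin.Base using (Fin; zero; suc)
import Data.Fin.Properties as Fin
open import Data.Vec.Base using (Vec; []; _∷_; zipWith; replicate)
open import Data.Vec.Properties using (≡-dec)
open import Data.List.Base using (List; []; _∷_; map; foldr; length; lookup; allFin)
open import Data.List.Properties using (map-cong)
open import Data.List.Relation.Unary.All as All using (All; all?)
open import Data.Product.Base using (proj₁; proj₂; _,_)
open import Relation.Nullary.Decidable using (from-yes)
open import Relation.Unary using (Decidable)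
open import Relation.Binary.Definitions using (DecidableEquality)
open import Relation.Binary.PropositionalEquality
open import Data.Rational.Solver using (module +-*-Solver)

pattern 0F = zero
pattern 1F = suc zero
pattern 2F = suc (suc zero)

fromℚᵘ-homo-+ : ∀ p q → fromℚᵘ (p ℚᵘ.+ q) ≡ fromℚᵘ p + fromℚᵘ q
fromℚᵘ-homo-+ p q = toℚᵘ-injective (begin-equality
  toℚᵘ (fromℚᵘ (p ℚᵘ.+ q))               ≃⟨ toℚᵘ-fromℚᵘ (p ℚᵘ.+ q) ⟩
  p ℚᵘ.+ q                               ≃⟨ ℚᵘ.+-cong (toℚᵘ-fromℚᵘ p) (toℚᵘ-fromℚᵘ q) ⟨
  toℚᵘ (fromℚᵘ p) ℚᵘ.+ toℚᵘ (fromℚᵘ q)   ≃⟨ toℚᵘ-homo-+ (fromℚᵘ p) (fromℚᵘ q) ⟨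
  toℚᵘ (fromℚᵘ p + fromℚᵘ q)             ∎)
  where open ℚᵘ.≤-Reasoning

fromℚᵘ-homo-* : ∀ p q → fromℚᵘ (p ℚᵘ.* q) ≡ fromℚᵘ p * fromℚᵘ q
fromℚᵘ-homo-* p q = toℚᵘ-injective (begin-equality
  toℚᵘ (fromℚᵘ (p ℚᵘ.* q))               ≃⟨ toℚᵘ-fromℚᵘ (p ℚᵘ.* q) ⟩
  p ℚᵘ.* q                               ≃⟨ ℚᵘ.*-cong (toℚᵘ-fromℚᵘ p) (toℚᵘ-fromℚᵘ q) ⟨
  toℚᵘ (fromℚᵘ p) ℚᵘ.* toℚᵘ (fromℚᵘ q)   ≃⟨ toℚᵘ-homo-* (fromℚᵘ p) (fromℚᵘ q) ⟨
  toℚᵘ (fromℚᵘ p * fromℚᵘ q)             ∎)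
  where open ℚᵘ.≤-Reasoning

ℕ→ℚ-nonNeg : ∀ n → NonNegative (ℕ→ℚ n)
ℕ→ℚ-nonNeg n = normalize-nonNeg n 1

fromℤ : ℤ → ℚ
fromℤ i = i / 1

fromℤ-homo-+ : ∀ i j → fromℤ (i ℤ.+ j) ≡ fromℤ i + fromℤ j
fromℤ-homo-+ i j =
  trans (fromℚᵘ-cong {mkℚᵘ (i ℤ.+ j) 0} {mkℚᵘ i 0 ℚᵘ.+ mkℚᵘ j 0} (*≡* (cross-multiplied i j)))
        (fromℚᵘ-homo-+ (mkℚᵘ i 0) (mkℚᵘ j 0))
  where
  cross-multiplied : ∀ i j → (i ℤ.+ j) ℤ.* 1ℤ ≡ (i ℤ.* 1ℤ ℤ.+ j ℤ.* 1ℤ) ℤ.* 1ℤ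
  cross-multiplied = ℤ-Solver.solve-∀

fromℤ-homo-* : ∀ i j → fromℤ (i ℤ.* j) ≡ fromℤ i * fromℤ j
fromℤ-homo-* i j =
  trans (fromℚᵘ-cong {mkℚᵘ (i ℤ.* j) 0} {mkℚᵘ i 0 ℚᵘ.* mkℚᵘ j 0} (*≡* refl))
        (fromℚᵘ-homo-* (mkℚᵘ i 0) (mkℚᵘ j 0))

open ≡-Reasoning
open +-*-Solver using (solve; _:=_; _:+_; _:*_; _:-_; :-_; con)

*-cancelˡ-≡ : ∀ a .{{_ : NonZero a}} {p q : ℚ} → a * p ≡ a * q → p ≡ q
*-cancelˡ-≡ a {p} {q} ap≡aq = begin
  p                  ≡⟨ sym (*-identityˡ p) ⟩
  1ℚ * p             ≡⟨ cong (_* p) (sym (*-inverseˡ a)) ⟩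
  (1/ a * a) * p     ≡⟨ *-assoc (1/ a) a p ⟩
  1/ a * (a * p)     ≡⟨ cong (1/ a *_) ap≡aq ⟩
  1/ a * (a * q)     ≡⟨ sym (*-assoc (1/ a) a q) ⟩
  (1/ a * a) * q     ≡⟨ cong (_* q) (*-inverseˡ a) ⟩
  1ℚ * q             ≡⟨ *-identityˡ q ⟩
  q                  ∎

-- Coefficient vectors of a + b x + c y and of a + b x + c y + d x² + e x y + f y², where x, y stand for r, ℓ.
-- The coefficients are integers because the symbolic computations below are run by
-- the type checker, and integer arithmetic reduces far faster than rational arithmetic.
Linear Quadratic : Set
Linear    = Vec ℤ 3
Quadratic = Vec ℤ 6

infixl 6 _⊕_
infixl 7 _⊗_
infix  4 _≟ᵠ_

_⊕_ : Quadratic → Quadratic → Quadratic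
_⊕_ = zipWith ℤ._+_

_⊗_ : Linear → Linear → Quadratic
(a ∷ b ∷ c ∷ []) ⊗ (a′ ∷ b′ ∷ c′ ∷ []) =
  a ℤ.* a′ ∷ a ℤ.* b′ ℤ.+ b ℤ.* a′ ∷ a ℤ.* c′ ℤ.+ c ℤ.* a′ ∷
  b ℤ.* b′ ∷ b ℤ.* c′ ℤ.+ c ℤ.* b′ ∷ c ℤ.* c′ ∷ []

0ᵠ : Quadratic
0ᵠ = replicate 6 0ℤ

sumᵠ : List Quadratic → Quadratic
sumᵠ = foldr _⊕_ 0ᵠ

Σ₃ᵠ : (Fin 3 → Quadratic) → Quadratic
Σ₃ᵠ f = f 0F ⊕ f 1F ⊕ f 2F

-- Symbolic counterpart of  p * memℚ v W ; the case split keeps an unselected p unevaluated.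
selectᵠ : ℕ → List ℕ → Quadratic → Quadratic
selectᵠ v []      p = 0ᵠ
selectᵠ v (w ∷ W) p = if v ≡ᵇ w then p else selectᵠ v W p

_≟ᵠ_ : DecidableEquality Quadratic
_≟ᵠ_ = ≡-dec _≟ℤ_

1ˡ xˡ yˡ 0ˡ : Linear
1ˡ = 1ℤ ∷ 0ℤ ∷ 0ℤ ∷ []
xˡ = 0ℤ ∷ 1ℤ ∷ 0ℤ ∷ []
yˡ = 0ℤ ∷ 0ℤ ∷ 1ℤ ∷ []
0ˡ = 0ℤ ∷ 0ℤ ∷ 0ℤ ∷ []

lamᵠ : Fin 3 → Fin 3 → Fin 3 → Linear
lamᵠ 0F 0F 0F = 1ˡ
lamᵠ 0F 1F 1F = 1ˡ
lamᵠ 0F 2F 2F = 1ˡ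
lamᵠ 1F 0F 1F = 1ˡ
lamᵠ 2F 0F 2F = 1ˡ
lamᵠ 1F 1F 0F = xˡ
lamᵠ 1F 1F 1F = -1ℤ ∷ 1ℤ ∷ 0ℤ ∷ []
lamᵠ 1F 2F 2F = xˡ
lamᵠ 2F 1F 2F = xˡ
lamᵠ 2F 2F 0F = yˡ
lamᵠ 2F 2F 1F = yˡ
lamᵠ 2F 2F 2F = -1ℤ ∷ -1ℤ ∷ 1ℤ ∷ []
lamᵠ _  _  _  = 0ˡ

χᵠ : Fin 3 → Fin 3 → Linear
χᵠ 0F 0F = 1ˡ
χᵠ 0F 1F = xˡ
χᵠ 0F 2F = yˡ
χᵠ 1F 0F = 1ˡ
χᵠ 1F 1F = xˡ
χᵠ 1F 2F = -1ℤ ∷ -1ℤ ∷ 0ℤ ∷ []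
χᵠ 2F 0F = 1ˡ
χᵠ 2F 1F = -1ℤ ∷ 0ℤ ∷ 0ℤ ∷ []
χᵠ 2F 2F = 0ˡ

lamᵠ-characters : ∀ c i j → Σ₃ᵠ (λ h → lamᵠ i j h ⊗ χᵠ c h) ≡ χᵠ c i ⊗ χᵠ c j
lamᵠ-characters = from-yes
  (Fin.all? λ c → Fin.all? λ i → Fin.all? λ j →
    Σ₃ᵠ (λ h → lamᵠ i j h ⊗ χᵠ c h) ≟ᵠ χᵠ c i ⊗ χᵠ c j)

lam⊗ᵠ : ℕ → ℕ → ℕ → Quadratic
lam⊗ᵠ t u v =
  lamᵠ (proj₁ (label t)) (proj₁ (label u)) (proj₁ (label v)) ⊗
  lamᵠ (proj₂ (label t)) (proj₂ (label u)) (proj₂ (label v))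

prodCoeffᵠ : List ℕ → List ℕ → ℕ → Quadratic
prodCoeffᵠ T U v = sumᵠ (map (λ t → sumᵠ (map (λ u → lam⊗ᵠ t u v) U)) T)

representative : List ℕ → ℕ
representative []      = 1
representative (t ∷ _) = t

-- The coefficient of a block sum in a product is read off at the first label of the block.
combinationᵠ : List (List ℕ) → List ℕ → List ℕ → ℕ → Quadratic
combinationᵠ G T U v =
  sumᵠ (map (λ k → selectᵠ v (lookup G k) (prodCoeffᵠ T U (representative (lookup G k))))
            (allFin (length G)))

SymbolicFusion : Partition → Set
SymbolicFusion τ =
  All (λ T → All (λ U → All (λ v → prodCoeffᵠ T U v ≡ combinationᵠ (generators τ) T U v)
                            labels)
                 (generators τ))
      (generators τ)

symbolicFusion? : Decidable SymbolicFusion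
symbolicFusion? τ =
  all? (λ T → all? (λ U → all? (λ v → prodCoeffᵠ T U v ≟ᵠ combinationᵠ (generators τ) T U v)
                               labels)
                   (generators τ))
       (generators τ)

theorem4p2Partitions-symbolicFusion : All SymbolicFusion theorem4p2Partitions
theorem4p2Partitions-symbolicFusion = from-yes (all? symbolicFusion? theorem4p2Partitions)

module Evaluation (x y : ℚ) where

  ⟦_⟧ₗ : Linear → ℚ
  ⟦ a ∷ b ∷ c ∷ [] ⟧ₗ = fromℤ a + fromℤ b * x + fromℤ c * y

  ⟦_⟧ : Quadratic → ℚ
  ⟦ a ∷ b ∷ c ∷ d ∷ e ∷ f ∷ [] ⟧ =
    fromℤ a + fromℤ b * x + fromℤ c * y + fromℤ d * (x * x) + fromℤ e * (x * y) + fromℤ f * (y * y)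

  ⊕-hom : ∀ p q → ⟦ p ⊕ q ⟧ ≡ ⟦ p ⟧ + ⟦ q ⟧
  ⊕-hom (a ∷ b ∷ c ∷ d ∷ e ∷ f ∷ []) (a′ ∷ b′ ∷ c′ ∷ d′ ∷ e′ ∷ f′ ∷ [])
    rewrite fromℤ-homo-+ a a′ | fromℤ-homo-+ b b′ | fromℤ-homo-+ c c′
          | fromℤ-homo-+ d d′ | fromℤ-homo-+ e e′ | fromℤ-homo-+ f f′ =
    add (fromℤ a) (fromℤ b) (fromℤ c) (fromℤ d) (fromℤ e) (fromℤ f)
        (fromℤ a′) (fromℤ b′) (fromℤ c′) (fromℤ d′) (fromℤ e′) (fromℤ f′) x y
    where
    add : ∀ a b c d e f a′ b′ c′ d′ e′ f′ x y →
      (a + a′) + (b + b′) * x + (c + c′) * y + (d + d′) * (x * x) + (e + e′) * (x * y) + (f + f′) * (y * y)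
      ≡ (a + b * x + c * y + d * (x * x) + e * (x * y) + f * (y * y))
        + (a′ + b′ * x + c′ * y + d′ * (x * x) + e′ * (x * y) + f′ * (y * y))
    add = solve 14 (λ a b c d e f a′ b′ c′ d′ e′ f′ x y →
      (a :+ a′) :+ (b :+ b′) :* x :+ (c :+ c′) :* y :+ (d :+ d′) :* (x :* x) :+ (e :+ e′) :* (x :* y) :+ (f :+ f′) :* (y :* y)
      := (a :+ b :* x :+ c :* y :+ d :* (x :* x) :+ e :* (x :* y) :+ f :* (y :* y))
         :+ (a′ :+ b′ :* x :+ c′ :* y :+ d′ :* (x :* x) :+ e′ :* (x :* y) :+ f′ :* (y :* y))) refl

  ⊗-hom : ∀ u w → ⟦ u ⊗ w ⟧ ≡ ⟦ u ⟧ₗ * ⟦ w ⟧ₗ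
  ⊗-hom (a ∷ b ∷ c ∷ []) (a′ ∷ b′ ∷ c′ ∷ [])
    rewrite fromℤ-homo-+ (a ℤ.* b′) (b ℤ.* a′) | fromℤ-homo-+ (a ℤ.* c′) (c ℤ.* a′)
          | fromℤ-homo-+ (b ℤ.* c′) (c ℤ.* b′)
          | fromℤ-homo-* a a′ | fromℤ-homo-* a b′ | fromℤ-homo-* b a′
          | fromℤ-homo-* a c′ | fromℤ-homo-* c a′ | fromℤ-homo-* b b′
          | fromℤ-homo-* b c′ | fromℤ-homo-* c b′ | fromℤ-homo-* c c′ =
    multiply (fromℤ a) (fromℤ b) (fromℤ c) (fromℤ a′) (fromℤ b′) (fromℤ c′) x y
    where
    multiply : ∀ a b c a′ b′ c′ x y →
      a * a′ + (a * b′ + b * a′) * x + (a * c′ + c * a′) * y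
        + b * b′ * (x * x) + (b * c′ + c * b′) * (x * y) + c * c′ * (y * y)
      ≡ (a + b * x + c * y) * (a′ + b′ * x + c′ * y)
    multiply = solve 8 (λ a b c a′ b′ c′ x y →
      a :* a′ :+ (a :* b′ :+ b :* a′) :* x :+ (a :* c′ :+ c :* a′) :* y
        :+ b :* b′ :* (x :* x) :+ (b :* c′ :+ c :* b′) :* (x :* y) :+ c :* c′ :* (y :* y)
      := (a :+ b :* x :+ c :* y) :* (a′ :+ b′ :* x :+ c′ :* y)) refl

  0ᵠ-hom : ⟦ 0ᵠ ⟧ ≡ 0ℚ
  0ᵠ-hom = vanish x y
    where
    vanish : ∀ x y →
      0ℚ + 0ℚ * x + 0ℚ * y + 0ℚ * (x * x) + 0ℚ * (x * y) + 0ℚ * (y * y) ≡ 0ℚ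
    vanish = solve 2 (λ x y →
      con 0ℚ :+ con 0ℚ :* x :+ con 0ℚ :* y :+ con 0ℚ :* (x :* x) :+ con 0ℚ :* (x :* y) :+ con 0ℚ :* (y :* y)
      := con 0ℚ) refl

  sumᵠ-hom : {B : Set} (f : B → Quadratic) (bs : List B) →
    ⟦ sumᵠ (map f bs) ⟧ ≡ sumℚ (map (λ b → ⟦ f b ⟧) bs)
  sumᵠ-hom f []       = 0ᵠ-hom
  sumᵠ-hom f (b ∷ bs) = trans (⊕-hom (f b) (sumᵠ (map f bs))) (cong (⟦ f b ⟧ +_) (sumᵠ-hom f bs))

  Σ₃ᵠ-hom : ∀ f → ⟦ Σ₃ᵠ f ⟧ ≡ Σ₃ (λ h → ⟦ f h ⟧)
  Σ₃ᵠ-hom f = begin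
    ⟦ f 0F ⊕ f 1F ⊕ f 2F ⟧              ≡⟨ ⊕-hom (f 0F ⊕ f 1F) (f 2F) ⟩
    ⟦ f 0F ⊕ f 1F ⟧ + ⟦ f 2F ⟧          ≡⟨ cong (_+ ⟦ f 2F ⟧) (⊕-hom (f 0F) (f 1F)) ⟩
    ⟦ f 0F ⟧ + ⟦ f 1F ⟧ + ⟦ f 2F ⟧      ∎

  selectᵠ-hom : ∀ v W p → ⟦ selectᵠ v W p ⟧ ≡ ⟦ p ⟧ * memℚ v W
  selectᵠ-hom v []      p = trans 0ᵠ-hom (sym (*-zeroʳ ⟦ p ⟧))
  selectᵠ-hom v (w ∷ W) p with v ≡ᵇ w
  ... | true  = sym (*-identityʳ ⟦ p ⟧)
  ... | false = selectᵠ-hom v W p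

  combinationᵠ-hom : ∀ G T U v → ⟦ combinationᵠ G T U v ⟧ ≡
    sumℚ (map (λ k → ⟦ prodCoeffᵠ T U (representative (lookup G k)) ⟧ * memℚ v (lookup G k))
              (allFin (length G)))
  combinationᵠ-hom G T U v = begin
    ⟦ combinationᵠ G T U v ⟧
      ≡⟨ sumᵠ-hom (λ k → selectᵠ v (block k) (representativeCoeff k)) (allFin (length G)) ⟩
    sumℚ (map (λ k → ⟦ selectᵠ v (block k) (representativeCoeff k) ⟧) (allFin (length G)))
      ≡⟨ cong sumℚ (map-cong (λ k → selectᵠ-hom v (block k) (representativeCoeff k)) (allFin (length G))) ⟩
    sumℚ (map (λ k → ⟦ representativeCoeff k ⟧ * memℚ v (block k)) (allFin (length G)))
      ∎
    where
    block : Fin (length G) → List ℕ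
    block = lookup G
    representativeCoeff : Fin (length G) → Quadratic
    representativeCoeff k = prodCoeffᵠ T U (representative (block k))

Σ₃-cong : ∀ {f g : Fin 3 → ℚ} → (∀ h → f h ≡ g h) → Σ₃ f ≡ Σ₃ g
Σ₃-cong f≗g = cong₂ _+_ (cong₂ _+_ (f≗g 0F) (f≗g 1F)) (f≗g 2F)

module CharacterTable (x y : ℚ) where

  open Evaluation x y

  χ : Fin 3 → Fin 3 → ℚ
  χ 0F = row 1ℚ x y
  χ 1F = row 1ℚ x (- 1ℚ + - x)
  χ 2F = row 1ℚ (- 1ℚ) 0ℚ

  χ-injective : .{{_ : NonZero (1ℚ + x)}} .{{_ : NonZero (1ℚ + x + y)}} →
    ∀ (z w : Fin 3 → ℚ) → (∀ c → Σ₃ (λ h → z h * χ c h) ≡ Σ₃ (λ h → w h * χ c h)) → ∀ h → z h ≡ w h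
  χ-injective z w same = coordinate
    where
    recover₂ : ∀ a b c x y →
      (1ℚ + x + y) * c ≡ (a * 1ℚ + b * x + c * y) - (a * 1ℚ + b * x + c * (- 1ℚ + - x))
    recover₂ = solve 5 (λ a b c x y →
      (con 1ℚ :+ x :+ y) :* c
      := (a :* con 1ℚ :+ b :* x :+ c :* y) :- (a :* con 1ℚ :+ b :* x :+ c :* (:- con 1ℚ :+ :- x))) refl

    recover₁ : ∀ a b c x →
      (1ℚ + x) * b ≡ (a * 1ℚ + b * x + c * (- 1ℚ + - x)) - (a * 1ℚ + b * - 1ℚ + c * 0ℚ) + (1ℚ + x) * c
    recover₁ = solve 4 (λ a b c x →
      (con 1ℚ :+ x) :* b
      := (a :* con 1ℚ :+ b :* x :+ c :* (:- con 1ℚ :+ :- x)) :- (a :* con 1ℚ :+ b :* :- con 1ℚ :+ c :* con 0ℚ)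
         :+ (con 1ℚ :+ x) :* c) refl

    recover₀ : ∀ a b c → a ≡ (a * 1ℚ + b * - 1ℚ + c * 0ℚ) + b
    recover₀ = solve 3 (λ a b c → a := (a :* con 1ℚ :+ b :* :- con 1ℚ :+ c :* con 0ℚ) :+ b) refl

    z₂≡w₂ : z 2F ≡ w 2F
    z₂≡w₂ = *-cancelˡ-≡ (1ℚ + x + y) (begin
      (1ℚ + x + y) * z 2F     ≡⟨ recover₂ (z 0F) (z 1F) (z 2F) x y ⟩
      _                       ≡⟨ cong₂ _-_ (same 0F) (same 1F) ⟩
      _                       ≡⟨ recover₂ (w 0F) (w 1F) (w 2F) x y ⟨
      (1ℚ + x + y) * w 2F     ∎)

    z₁≡w₁ : z 1F ≡ w 1F
    z₁≡w₁ = *-cancelˡ-≡ (1ℚ + x) (begin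
      (1ℚ + x) * z 1F         ≡⟨ recover₁ (z 0F) (z 1F) (z 2F) x ⟩
      _                       ≡⟨ cong₂ _+_ (cong₂ _-_ (same 1F) (same 2F)) (cong ((1ℚ + x) *_) z₂≡w₂) ⟩
      _                       ≡⟨ recover₁ (w 0F) (w 1F) (w 2F) x ⟨
      (1ℚ + x) * w 1F         ∎)

    z₀≡w₀ : z 0F ≡ w 0F
    z₀≡w₀ = begin
      z 0F                    ≡⟨ recover₀ (z 0F) (z 1F) (z 2F) ⟩
      _                       ≡⟨ cong₂ _+_ (same 2F) z₁≡w₁ ⟩
      _                       ≡⟨ recover₀ (w 0F) (w 1F) (w 2F) ⟨
      w 0F                    ∎

    coordinate : ∀ h → z h ≡ w h
    coordinate 0F = z₀≡w₀
    coordinate 1F = z₁≡w₁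
    coordinate 2F = z₂≡w₂

  ⟦χᵠ⟧≡χ : ∀ c h → ⟦ χᵠ c h ⟧ₗ ≡ χ c h
  ⟦χᵠ⟧≡χ = entry
    where
    constant : ∀ a x y → a + 0ℚ * x + 0ℚ * y ≡ a
    constant = solve 3 (λ a x y → a :+ con 0ℚ :* x :+ con 0ℚ :* y := a) refl
    only-x : ∀ x y → 0ℚ + 1ℚ * x + 0ℚ * y ≡ x
    only-x = solve 2 (λ x y → con 0ℚ :+ con 1ℚ :* x :+ con 0ℚ :* y := x) refl
    only-y : ∀ x y → 0ℚ + 0ℚ * x + 1ℚ * y ≡ y
    only-y = solve 2 (λ x y → con 0ℚ :+ con 0ℚ :* x :+ con 1ℚ :* y := y) refl
    negated : ∀ x y → - 1ℚ + - 1ℚ * x + 0ℚ * y ≡ - 1ℚ + - x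
    negated = solve 2 (λ x y → :- con 1ℚ :+ :- con 1ℚ :* x :+ con 0ℚ :* y := :- con 1ℚ :+ :- x) refl

    entry : ∀ c h → ⟦ χᵠ c h ⟧ₗ ≡ χ c h
    entry 0F 0F = constant 1ℚ x y
    entry 0F 1F = only-x x y
    entry 0F 2F = only-y x y
    entry 1F 0F = constant 1ℚ x y
    entry 1F 1F = only-x x y
    entry 1F 2F = negated x y
    entry 2F 0F = constant 1ℚ x y
    entry 2F 1F = constant (- 1ℚ) x y
    entry 2F 2F = constant 0ℚ x y

  ⟦lamᵠ⟧-character : ∀ c i j → Σ₃ (λ h → ⟦ lamᵠ i j h ⟧ₗ * χ c h) ≡ χ c i * χ c j
  ⟦lamᵠ⟧-character c i j = begin
    Σ₃ (λ h → ⟦ lamᵠ i j h ⟧ₗ * χ c h)        ≡⟨ Σ₃-cong (λ h → cong (⟦ lamᵠ i j h ⟧ₗ *_) (⟦χᵠ⟧≡χ c h)) ⟨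
    Σ₃ (λ h → ⟦ lamᵠ i j h ⟧ₗ * ⟦ χᵠ c h ⟧ₗ)  ≡⟨ Σ₃-cong (λ h → ⊗-hom (lamᵠ i j h) (χᵠ c h)) ⟨
    Σ₃ (λ h → ⟦ lamᵠ i j h ⊗ χᵠ c h ⟧)        ≡⟨ Σ₃ᵠ-hom (λ h → lamᵠ i j h ⊗ χᵠ c h) ⟨
    ⟦ Σ₃ᵠ (λ h → lamᵠ i j h ⊗ χᵠ c h) ⟧       ≡⟨ cong ⟦_⟧ (lamᵠ-characters c i j) ⟩
    ⟦ χᵠ c i ⊗ χᵠ c j ⟧                       ≡⟨ ⊗-hom (χᵠ c i) (χᵠ c j) ⟩
    ⟦ χᵠ c i ⟧ₗ * ⟦ χᵠ c j ⟧ₗ                 ≡⟨ cong₂ _*_ (⟦χᵠ⟧≡χ c i) (⟦χᵠ⟧≡χ c j) ⟩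
    χ c i * χ c j                             ∎

module _ (A : TableAlgebra3) (r m : ℚ) (H : HasCharTable A r m) where

  private
    ℓ : ℚ
    ℓ = m * (1ℚ + r)

  open Evaluation r ℓ
  open CharacterTable r ℓ

  private instance
    r-nonNeg : NonNegative r
    r-nonNeg = subst NonNegative (proj₁ H 1F) (ℕ→ℚ-nonNeg (δ A 1F))
    ℓ-nonNeg : NonNegative ℓ
    ℓ-nonNeg = subst NonNegative (proj₁ H 2F) (ℕ→ℚ-nonNeg (δ A 2F))
    1+r-pos : Positive (1ℚ + r)
    1+r-pos = pos+nonNeg⇒pos 1ℚ r
    1+r-nonZero : NonZero (1ℚ + r)
    1+r-nonZero = pos⇒nonZero (1ℚ + r)
    1+r+ℓ-nonZero : NonZero (1ℚ + r + ℓ)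
    1+r+ℓ-nonZero = pos⇒nonZero (1ℚ + r + ℓ) {{pos+nonNeg⇒pos (1ℚ + r) ℓ}}

  χ-isCharacter : ∀ c → IsCharacter A (χ c)
  χ-isCharacter 0F = proj₁ (proj₂ H)
  χ-isCharacter 1F = proj₁ (proj₂ (proj₂ H))
  χ-isCharacter 2F = proj₂ (proj₂ (proj₂ H))

  lam≡⟦lamᵠ⟧ : ∀ i j h → lam A i j h ≡ ⟦ lamᵠ i j h ⟧ₗ
  lam≡⟦lamᵠ⟧ i j = χ-injective (lam A i j) (λ h → ⟦ lamᵠ i j h ⟧ₗ)
    (λ c → trans (sym (χ-isCharacter c i j)) (sym (⟦lamᵠ⟧-character c i j)))

  lam⊗≡⟦lam⊗ᵠ⟧ : ∀ t u v → lam⊗ A t u v ≡ ⟦ lam⊗ᵠ t u v ⟧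
  lam⊗≡⟦lam⊗ᵠ⟧ t u v = begin
    lam⊗ A t u v                    ≡⟨ cong₂ _*_ (lam≡⟦lamᵠ⟧ i i′ i″) (lam≡⟦lamᵠ⟧ j j′ j″) ⟩
    ⟦ lamᵠ i i′ i″ ⟧ₗ * ⟦ lamᵠ j j′ j″ ⟧ₗ  ≡⟨ ⊗-hom (lamᵠ i i′ i″) (lamᵠ j j′ j″) ⟨
    ⟦ lam⊗ᵠ t u v ⟧                 ∎
    where
    i = proj₁ (label t); i′ = proj₁ (label u); i″ = proj₁ (label v)
    j = proj₂ (label t); j′ = proj₂ (label u); j″ = proj₂ (label v)

  prodCoeff≡⟦prodCoeffᵠ⟧ : ∀ T U v → prodCoeff A T U v ≡ ⟦ prodCoeffᵠ T U v ⟧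
  prodCoeff≡⟦prodCoeffᵠ⟧ T U v = begin
    prodCoeff A T U v
      ≡⟨ cong sumℚ (map-cong (λ t → begin
           sumℚ (map (λ u → lam⊗ A t u v) U)      ≡⟨ cong sumℚ (map-cong (λ u → lam⊗≡⟦lam⊗ᵠ⟧ t u v) U) ⟩
           sumℚ (map (λ u → ⟦ lam⊗ᵠ t u v ⟧) U)   ≡⟨ sumᵠ-hom (λ u → lam⊗ᵠ t u v) U ⟨
           ⟦ sumᵠ (map (λ u → lam⊗ᵠ t u v) U) ⟧   ∎) T) ⟩
    sumℚ (map (λ t → ⟦ sumᵠ (map (λ u → lam⊗ᵠ t u v) U) ⟧) T)
      ≡⟨ sumᵠ-hom (λ t → sumᵠ (map (λ u → lam⊗ᵠ t u v) U)) T ⟨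
    ⟦ prodCoeffᵠ T U v ⟧
      ∎

  symbolicFusion⇒isFusion : ∀ {τ} → SymbolicFusion τ → IsFusion A τ
  symbolicFusion⇒isFusion {τ} closed {T} {U} T∈ U∈ = coefficient , λ {v} v∈ → begin
    prodCoeff A T U v          ≡⟨ prodCoeff≡⟦prodCoeffᵠ⟧ T U v ⟩
    ⟦ prodCoeffᵠ T U v ⟧        ≡⟨ cong ⟦_⟧ (All.lookup (All.lookup (All.lookup closed T∈) U∈) v∈) ⟩
    ⟦ combinationᵠ G T U v ⟧    ≡⟨ combinationᵠ-hom G T U v ⟩
    sumℚ (map (λ k → coefficient k * memℚ v (lookup G k)) (allFin (length G))) ∎
    where
    G = generators τ
    coefficient : Fin (length G) → ℚ
    coefficient k = ⟦ prodCoeffᵠ T U (representative (lookup G k)) ⟧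

theorem4p2 : (A : TableAlgebra3) (r m : ℚ) → HasCharTable A r m →
    All (IsFusion A) theorem4p2Partitions
theorem4p2 A r m H = All.map (symbolicFusion⇒isFusion A r m H) theorem4p2Partitions-symbolicFusion
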